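{- Let $k$ be a non-negative integer. For $|q|<1$, $$(q;q)^2_\infty \sum_{j=0}^\infty \frac{q^{2j+k}}{(q;q)_j\,(q;q)_{j+k}} = -1+(1+q^k) \sum_{j=k}^\infty (-1)^{j-k}\,q^{j(j+1)/2-k(k+1)/2}.$$
   Context: For $n\ge0$, $(a;q)_n=\prod_{r=0}^{n-1}(1-aq^r)$ with $(a;q)_0=1$, and $(a;q)_\infty=\lim_{n\to\infty}(a;q)_n$ for $|q|<1$. -}

module Defs where

-- Formal power series in q with integer coefficients, represented by their
-- coefficient sequences.  For |q|<1 both sides of the identity are absolutely
-- convergent power series, so (identity theorem) the analytic identity is
-- equivalent to equality of all coefficients.

open import Data.Nat as ℕ using (ℕ; zero; suc; _∸_)
open import Data.Integer as ℤ using (ℤ; +_; -_)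
open import Data.List using (List; []; _∷_; upTo; map; zipWith; length; foldr)
open import Data.Bool using (if_then_else_)
open import Relation.Nullary.Decidable using (⌊_⌋)

sum : List ℤ → ℤ
sum = foldr ℤ._+_ (+ 0)

PS : Set
PS = ℕ → ℤ

const : ℤ → PS
const c zero    = c
const c (suc _) = + 0

X^ : ℕ → PS
X^ m n = if ⌊ n ℕ.≟ m ⌋ then + 1 else + 0

infixl 6 _⊕_
infixl 7 _⊛_

_⊕_ : PS → PS → PS
(f ⊕ g) n = f n ℤ.+ g n

⊝_ : PS → PS
(⊝ f) n = - f n

_⊛_ : PS → PS → PS
(f ⊛ g) n = sum (map (λ i → f i ℤ.* g (n ∸ i)) (upTo (suc n)))

-- Multiplicative inverse of a power series with constant term 1:
-- b₀ = 1, b_{n} = - Σ_{i=1}^{n} a_i b_{n-i}.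
-- invList a n = [b_n, b_{n-1}, ..., b_0]
invList : PS → ℕ → List ℤ
invList a zero = + 1 ∷ []
invList a (suc n) with invList a n
... | bs = (- sum (zipWith ℤ._*_ (map (λ i → a (suc i)) (upTo (length bs))) bs)) ∷ bs

inv : PS → PS
inv a n with invList a n
... | []    = + 0
... | b ∷ _ = b

qq : ℕ → PS
qq zero    = const (+ 1)
qq (suc m) = qq m ⊛ (const (+ 1) ⊕ ⊝ X^ (suc m))

-- (q;q)_∞ : the n-th coefficient of the infinite product equals the n-th
-- coefficient of (q;q)_n (factors 1-q^r with r>n do not affect it).
qqInf : PS
qqInf n = qq n n

-- Sum of a family of power series f₀, f₁, ... where f_j has q-adic valuation
-- ≥ j (so the sum converges formally): the n-th coefficient is
-- Σ_{j=0}^{n} (f_j)_n.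
Σ∞ : (ℕ → PS) → PS
Σ∞ f n = sum (map (λ j → f j n) (upTo (suc n)))

sgn : ℕ → ℤ
sgn zero    = + 1
sgn (suc i) = - sgn i

LHS : ℕ → PS
LHS k = qqInf ⊛ qqInf ⊛
  Σ∞ (λ j → X^ (2 ℕ.* j ℕ.+ k) ⊛ inv (qq j) ⊛ inv (qq (j ℕ.+ k)))

-- the RHS: -1 + (1+q^k) Σ_{j≥k} (-1)^{j-k} q^{j(j+1)/2 - k(k+1)/2},
-- with the sum re-indexed by i = j - k (j = k + i).
tri : ℕ → ℕ
tri j = (j ℕ.* (j ℕ.+ 1)) ℕ./ 2

RHS : ℕ → PS
RHS k = const (- + 1) ⊕ (const (+ 1) ⊕ X^ k) ⊛
  Σ∞ (λ i → const (sgn ((k ℕ.+ i) ∸ k)) ⊛ X^ (tri (k ℕ.+ i) ∸ tri k))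

{-# OPTIONS --safe #-}
-- Write T a = (q^(1+a);q)_∞, so that (q;q)_∞ = (q;q)_j T j and the left-hand side is
-- q^k V k, where V k = Σ_j q^(2j) T j T (j+k).  Put U k = Σ_j q^j T j T (j+k).  Using
-- T j = (1 - q^(1+j)) T (1+j) on the first, resp. the second, factor gives
-- U k = V k + q U (1+k) and U k = U (1+k) - q^(1+k) V (1+k), so G = U satisfies
-- G k = (1 - q^(1+k)) G (1+k) + q^(2+k) G (2+k) and G k ≡ 1 (mod q^(1+k)).  The partial
-- theta series S k = Σ_i (-1)^i q^(ik + i(i+1)/2) satisfies S k = 1 - q^(1+k) S (1+k), hence
-- the same recurrence and normalisation.  These determine G k modulo every power of q,
-- so U = S, and the left-hand side is q^k (S k - q S (1+k)) = q^k S k - (1 - S k).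

module Submission where

open import Defs
open import Data.Nat as ℕ using (ℕ; zero; suc; _∸_; _≤_; _<_; z≤n; s≤s; _+_; _*_)
import Data.Nat.Properties as ℕ
open import Data.Integer as ℤ using (ℤ; +_; -_)
import Data.Integer.Properties as ℤ
open import Data.Integer.Solver using (module +-*-Solver)
open import Data.Nat.Tactic.RingSolver using (solve-∀)
open import Data.Nat.Divisibility using (divides)
open import Data.Nat.DivMod using (_/_; +-distrib-/-∣ʳ; m*n/n≡m)
open import Data.List using (_∷_; applyUpTo; map; upTo; zipWith; length)
open import Data.List.Properties using (map-upTo; length-applyUpTo)
open import Data.Sum using (inj₁; inj₂)
open import Data.Product using (_,_)
open import Data.Maybe using (Maybe; just; nothing)
open import Function using (_∘_; id)
open import Data.Bool using (if_then_else_)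
open import Relation.Nullary.Decidable using (isYes≗does; dec-true; dec-false)
open import Relation.Nullary using (Dec; yes; no)
open import Relation.Binary.PropositionalEquality
  using (_≡_; _≢_; refl; sym; trans; cong; cong₂; module ≡-Reasoning)
open import Algebra.Bundles using (CommutativeRing)
open import Relation.Binary.Bundles using (Setoid)
open import Algebra.Structures using (IsCommutativeRing)
open import Algebra.Solver.Ring.AlmostCommutativeRing
  using (fromCommutativeRing; _-Raw-AlmostCommutative⟶_)
import Algebra.Solver.Ring as RingSolver
import Relation.Binary.Reasoning.Setoid as SetoidReasoning

∑< : ℕ → (ℕ → ℤ) → ℤ
∑< n f = sum (applyUpTo f n)

syntax ∑< n (λ i → e) = ∑[ i < n ] e

module _ where
  open ≡-Reasoning

  ∑-cong-< : ∀ n {f g : ℕ → ℤ} → (∀ i → i < n → f i ≡ g i) → ∑< n f ≡ ∑< n g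
  ∑-cong-< zero    eq = refl
  ∑-cong-< (suc n) eq = cong₂ ℤ._+_ (eq 0 (s≤s z≤n)) (∑-cong-< n (λ i i<n → eq (suc i) (s≤s i<n)))

  ∑-cong : ∀ n {f g : ℕ → ℤ} → (∀ i → f i ≡ g i) → ∑< n f ≡ ∑< n g
  ∑-cong n eq = ∑-cong-< n (λ i _ → eq i)

  ∑-zero : ∀ n {f : ℕ → ℤ} → (∀ i → i < n → f i ≡ + 0) → ∑< n f ≡ + 0
  ∑-zero zero    eq = refl
  ∑-zero (suc n) eq = cong₂ ℤ._+_ (eq 0 (s≤s z≤n)) (∑-zero n (λ i i<n → eq (suc i) (s≤s i<n)))

  ∑-distrib-+ : ∀ n (f g : ℕ → ℤ) → ∑[ i < n ] (f i ℤ.+ g i) ≡ ∑< n f ℤ.+ ∑< n g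
  ∑-distrib-+ zero    f g = refl
  ∑-distrib-+ (suc n) f g = begin
    f 0 ℤ.+ g 0 ℤ.+ ∑[ i < n ] (f (suc i) ℤ.+ g (suc i))
      ≡⟨ cong (ℤ._+_ (f 0 ℤ.+ g 0)) (∑-distrib-+ n (f ∘ suc) (g ∘ suc)) ⟩
    f 0 ℤ.+ g 0 ℤ.+ (∑< n (f ∘ suc) ℤ.+ ∑< n (g ∘ suc))
      ≡⟨ solve 4 (λ a b c d → (a :+ b) :+ (c :+ d) := (a :+ c) :+ (b :+ d)) refl
           (f 0) (g 0) (∑< n (f ∘ suc)) (∑< n (g ∘ suc)) ⟩
    ∑< (suc n) f ℤ.+ ∑< (suc n) g ∎
    where open +-*-Solver

  *-distribˡ-∑ : ∀ n c (f : ℕ → ℤ) → c ℤ.* ∑< n f ≡ ∑[ i < n ] (c ℤ.* f i)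
  *-distribˡ-∑ zero    c f = ℤ.*-zeroʳ c
  *-distribˡ-∑ (suc n) c f =
    trans (ℤ.*-distribˡ-+ c (f 0) (∑< n (f ∘ suc))) (cong (ℤ._+_ (c ℤ.* f 0)) (*-distribˡ-∑ n c (f ∘ suc)))

  neg-distrib-∑ : ∀ n (f : ℕ → ℤ) → - ∑< n f ≡ ∑[ i < n ] (- f i)
  neg-distrib-∑ zero    f = refl
  neg-distrib-∑ (suc n) f =
    trans (ℤ.neg-distrib-+ (f 0) (∑< n (f ∘ suc))) (cong (ℤ._+_ (- f 0)) (neg-distrib-∑ n (f ∘ suc)))

  ∑-comm : ∀ m n (h : ℕ → ℕ → ℤ) → ∑[ i < m ] ∑< n (h i) ≡ ∑[ j < n ] ∑[ i < m ] h i j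
  ∑-comm zero    n h = sym (∑-zero n (λ _ _ → refl))
  ∑-comm (suc m) n h = trans (cong (ℤ._+_ (∑< n (h 0))) (∑-comm m n (h ∘ suc)))
                             (sym (∑-distrib-+ n (h 0) (λ j → ∑[ i < m ] h (suc i) j)))

  ∑-snoc : ∀ n (f : ℕ → ℤ) → ∑< (suc n) f ≡ ∑< n f ℤ.+ f n
  ∑-snoc zero    f = ℤ.+-comm (f 0) (+ 0)
  ∑-snoc (suc n) f = trans (cong (ℤ._+_ (f 0)) (∑-snoc n (f ∘ suc))) (sym (ℤ.+-assoc (f 0) _ (f (suc n))))

  ∑-reverse : ∀ n (f : ℕ → ℤ) → ∑< (suc n) f ≡ ∑[ i < suc n ] f (n ∸ i)
  ∑-reverse zero    f = refl
  ∑-reverse (suc n) f = begin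
    f 0 ℤ.+ ∑< (suc n) (f ∘ suc)                     ≡⟨ cong (ℤ._+_ (f 0)) (∑-reverse n (f ∘ suc)) ⟩
    f 0 ℤ.+ ∑[ i < suc n ] f (suc (n ∸ i))           ≡⟨ ℤ.+-comm (f 0) _ ⟩
    ∑[ i < suc n ] f (suc (n ∸ i)) ℤ.+ f 0
      ≡⟨ cong₂ ℤ._+_ (∑-cong-< (suc n) (λ i i<1+n → cong f (sym (ℕ.+-∸-assoc 1 (ℕ.≤-pred i<1+n)))))
                     (cong f (sym (ℕ.n∸n≡0 n))) ⟩
    ∑[ i < suc n ] f (suc n ∸ i) ℤ.+ f (suc n ∸ suc n) ≡⟨ sym (∑-snoc (suc n) (λ i → f (suc n ∸ i))) ⟩
    ∑[ i < suc (suc n) ] f (suc n ∸ i)                ∎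

  ∑-extend : ∀ m n (f : ℕ → ℤ) → m ≤ n → (∀ i → m ≤ i → f i ≡ + 0) → ∑< n f ≡ ∑< m f
  ∑-extend m zero    f z≤n     _    = refl
  ∑-extend m (suc n) f m≤1+n   vanish with ℕ.m≤n⇒m<n∨m≡n m≤1+n
  ... | inj₂ refl       = refl
  ... | inj₁ (s≤s m≤n) = begin
    ∑< (suc n) f      ≡⟨ ∑-snoc n f ⟩
    ∑< n f ℤ.+ f n    ≡⟨ cong₂ ℤ._+_ (∑-extend m n f m≤n vanish) (vanish n m≤n) ⟩
    ∑< m f ℤ.+ + 0    ≡⟨ ℤ.+-identityʳ _ ⟩
    ∑< m f            ∎

infix 4 _≈_ _≈[_]_

record _≈_ (f g : PS) : Set where
  constructor coeffwise
  field coeff : ∀ n → f n ≡ g n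
open _≈_ public

-- f ≡ g (mod q^(1+N))
record _≈[_]_ (f : PS) (N : ℕ) (g : PS) : Set where
  constructor coeffwise≤
  field coeff≤ : ∀ n → n ≤ N → f n ≡ g n
open _≈[_]_ public

≈-refl : ∀ {f} → f ≈ f
≈-refl = coeffwise λ _ → refl

≈-sym : ∀ {f g} → f ≈ g → g ≈ f
≈-sym f≈g = coeffwise λ n → sym (coeff f≈g n)

≈-trans : ∀ {f g h} → f ≈ g → g ≈ h → f ≈ h
≈-trans f≈g g≈h = coeffwise λ n → trans (coeff f≈g n) (coeff g≈h n)

≈⇒≈[] : ∀ {f g} N → f ≈ g → f ≈[ N ] g
≈⇒≈[] N f≈g = coeffwise≤ (λ n _ → coeff f≈g n)

cong≈ : ∀ {A : Set} (f : A → PS) {a b} → a ≡ b → f a ≈ f b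
cong≈ f refl = ≈-refl

≈[]-refl : ∀ {f N} → f ≈[ N ] f
≈[]-refl = coeffwise≤ λ _ _ → refl

≈[]-sym : ∀ {f g N} → f ≈[ N ] g → g ≈[ N ] f
≈[]-sym f≈g = coeffwise≤ λ n n≤N → sym (coeff≤ f≈g n n≤N)

≈[]-trans : ∀ {f g h N} → f ≈[ N ] g → g ≈[ N ] h → f ≈[ N ] h
≈[]-trans f≈g g≈h = coeffwise≤ λ n n≤N → trans (coeff≤ f≈g n n≤N) (coeff≤ g≈h n n≤N)

≈[]-weaken : ∀ {f g M N} → M ≤ N → f ≈[ N ] g → f ≈[ M ] g
≈[]-weaken M≤N f≈g = coeffwise≤ λ n n≤M → coeff≤ f≈g n (ℕ.≤-trans n≤M M≤N)

≈[]-all⇒≈ : ∀ {f g} → (∀ N → f ≈[ N ] g) → f ≈ g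
≈[]-all⇒≈ f≈g = coeffwise λ n → coeff≤ (f≈g n) n ℕ.≤-refl

≈[]-setoid : ℕ → Setoid _ _
≈[]-setoid N = record
  { Carrier = PS
  ; _≈_ = _≈[ N ]_
  ; isEquivalence = record { refl = ≈[]-refl ; sym = ≈[]-sym ; trans = ≈[]-trans } }

-- The ring of power series

𝟘 𝟙 : PS
𝟘 = const (+ 0)
𝟙 = const (+ 1)

tail : PS → PS
tail f n = f (suc n)

infixr 8 _·_

_·_ : ℤ → PS → PS
(c · f) n = c ℤ.* f n

const0≡0 : ∀ n → 𝟘 n ≡ + 0
const0≡0 zero    = refl
const0≡0 (suc n) = refl

⊛-coeff : ∀ f g n → (f ⊛ g) n ≡ ∑[ i < suc n ] (f i ℤ.* g (n ∸ i))
⊛-coeff f g n = cong sum (map-upTo (λ i → f i ℤ.* g (n ∸ i)) (suc n))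

⊛-coeff-suc : ∀ f g n → (f ⊛ g) (suc n) ≡ f 0 ℤ.* g (suc n) ℤ.+ (tail f ⊛ g) n
⊛-coeff-suc f g n =
  trans (⊛-coeff f g (suc n)) (cong (ℤ._+_ (f 0 ℤ.* g (suc n))) (sym (⊛-coeff (tail f) g n)))

Σ∞-coeff : ∀ f n → Σ∞ f n ≡ ∑[ j < suc n ] f j n
Σ∞-coeff f n = cong sum (map-upTo (λ j → f j n) (suc n))

⊕-cong-≈[] : ∀ {f f′ g g′ N} → f ≈[ N ] f′ → g ≈[ N ] g′ → f ⊕ g ≈[ N ] f′ ⊕ g′
⊕-cong-≈[] f≈f′ g≈g′ = coeffwise≤ λ n n≤N → cong₂ ℤ._+_ (coeff≤ f≈f′ n n≤N) (coeff≤ g≈g′ n n≤N)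

⊛-cong-≈[] : ∀ {f f′ g g′ N} → f ≈[ N ] f′ → g ≈[ N ] g′ → f ⊛ g ≈[ N ] f′ ⊛ g′
⊛-cong-≈[] {f} {f′} {g} {g′} f≈f′ g≈g′ = coeffwise≤ λ n n≤N → begin
  (f ⊛ g) n                                 ≡⟨ ⊛-coeff f g n ⟩
  ∑[ i < suc n ] (f i ℤ.* g (n ∸ i))
    ≡⟨ ∑-cong-< (suc n) (λ i i≤n → cong₂ ℤ._*_ (coeff≤ f≈f′ i (ℕ.≤-trans (ℕ.≤-pred i≤n) n≤N))
                                                (coeff≤ g≈g′ (n ∸ i) (ℕ.≤-trans (ℕ.m∸n≤m n i) n≤N))) ⟩
  ∑[ i < suc n ] (f′ i ℤ.* g′ (n ∸ i))      ≡⟨ sym (⊛-coeff f′ g′ n) ⟩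
  (f′ ⊛ g′) n                               ∎
  where open ≡-Reasoning

⊛-cong : ∀ {f f′ g g′} → f ≈ f′ → g ≈ g′ → f ⊛ g ≈ f′ ⊛ g′
⊛-cong f≈f′ g≈g′ = coeffwise λ n →
  coeff≤ (⊛-cong-≈[] (≈⇒≈[] n f≈f′) (≈⇒≈[] n g≈g′)) n ℕ.≤-refl

module _ where
  open ≡-Reasoning

  ⊛-comm : ∀ f g → f ⊛ g ≈ g ⊛ f
  ⊛-comm f g = coeffwise λ n → begin
    (f ⊛ g) n                                    ≡⟨ ⊛-coeff f g n ⟩
    ∑[ i < suc n ] (f i ℤ.* g (n ∸ i))           ≡⟨ ∑-reverse n (λ i → f i ℤ.* g (n ∸ i)) ⟩
    ∑[ i < suc n ] (f (n ∸ i) ℤ.* g (n ∸ (n ∸ i)))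
      ≡⟨ ∑-cong-< (suc n) (λ i i≤n → trans (cong (λ j → f (n ∸ i) ℤ.* g j) (ℕ.m∸[m∸n]≡n (ℕ.≤-pred i≤n)))
                                           (ℤ.*-comm (f (n ∸ i)) (g i))) ⟩
    ∑[ i < suc n ] (g i ℤ.* f (n ∸ i))           ≡⟨ sym (⊛-coeff g f n) ⟩
    (g ⊛ f) n                                    ∎

  ⊛-distribʳ-⊕ : ∀ f g h → (f ⊕ g) ⊛ h ≈ f ⊛ h ⊕ g ⊛ h
  ⊛-distribʳ-⊕ f g h = coeffwise λ n → begin
    ((f ⊕ g) ⊛ h) n                              ≡⟨ ⊛-coeff (f ⊕ g) h n ⟩
    ∑[ i < suc n ] ((f i ℤ.+ g i) ℤ.* h (n ∸ i))
      ≡⟨ ∑-cong (suc n) (λ i → ℤ.*-distribʳ-+ (h (n ∸ i)) (f i) (g i)) ⟩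
    ∑[ i < suc n ] (f i ℤ.* h (n ∸ i) ℤ.+ g i ℤ.* h (n ∸ i))
      ≡⟨ ∑-distrib-+ (suc n) (λ i → f i ℤ.* h (n ∸ i)) (λ i → g i ℤ.* h (n ∸ i)) ⟩
    ∑[ i < suc n ] (f i ℤ.* h (n ∸ i)) ℤ.+ ∑[ i < suc n ] (g i ℤ.* h (n ∸ i))
      ≡⟨ sym (cong₂ ℤ._+_ (⊛-coeff f h n) (⊛-coeff g h n)) ⟩
    (f ⊛ h ⊕ g ⊛ h) n                            ∎

  ⊛-distribˡ-⊕ : ∀ f g h → f ⊛ (g ⊕ h) ≈ f ⊛ g ⊕ f ⊛ h
  ⊛-distribˡ-⊕ f g h = coeffwise λ n → begin
    (f ⊛ (g ⊕ h)) n                              ≡⟨ ⊛-coeff f (g ⊕ h) n ⟩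
    ∑[ i < suc n ] (f i ℤ.* (g (n ∸ i) ℤ.+ h (n ∸ i)))
      ≡⟨ ∑-cong (suc n) (λ i → ℤ.*-distribˡ-+ (f i) (g (n ∸ i)) (h (n ∸ i))) ⟩
    ∑[ i < suc n ] (f i ℤ.* g (n ∸ i) ℤ.+ f i ℤ.* h (n ∸ i))
      ≡⟨ ∑-distrib-+ (suc n) (λ i → f i ℤ.* g (n ∸ i)) (λ i → f i ℤ.* h (n ∸ i)) ⟩
    ∑[ i < suc n ] (f i ℤ.* g (n ∸ i)) ℤ.+ ∑[ i < suc n ] (f i ℤ.* h (n ∸ i))
      ≡⟨ sym (cong₂ ℤ._+_ (⊛-coeff f g n) (⊛-coeff f h n)) ⟩
    (f ⊛ g ⊕ f ⊛ h) n                            ∎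

  ·-⊛ : ∀ c f g → (c · f) ⊛ g ≈ c · (f ⊛ g)
  ·-⊛ c f g = coeffwise λ n → begin
    ((c · f) ⊛ g) n                              ≡⟨ ⊛-coeff (c · f) g n ⟩
    ∑[ i < suc n ] (c ℤ.* f i ℤ.* g (n ∸ i))
      ≡⟨ ∑-cong (suc n) (λ i → ℤ.*-assoc c (f i) (g (n ∸ i))) ⟩
    ∑[ i < suc n ] (c ℤ.* (f i ℤ.* g (n ∸ i)))   ≡⟨ sym (*-distribˡ-∑ (suc n) c (λ i → f i ℤ.* g (n ∸ i))) ⟩
    c ℤ.* ∑[ i < suc n ] (f i ℤ.* g (n ∸ i))     ≡⟨ cong (c ℤ.*_) (sym (⊛-coeff f g n)) ⟩
    (c · (f ⊛ g)) n                              ∎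

  tail-⊛ : ∀ f g → tail (f ⊛ g) ≈ f 0 · tail g ⊕ tail f ⊛ g
  tail-⊛ f g = coeffwise (⊛-coeff-suc f g)

  -- Peeling off the constant term of f reduces associativity in degree n+1 to degree n.
  ⊛-assoc-coeff : ∀ f g h n → ((f ⊛ g) ⊛ h) n ≡ (f ⊛ (g ⊛ h)) n
  ⊛-assoc-coeff f g h zero =
    solve 3 (λ a b c → (a :* b :+ con (+ 0)) :* c :+ con (+ 0) := a :* (b :* c :+ con (+ 0)) :+ con (+ 0))
      refl (f 0) (g 0) (h 0)
    where open +-*-Solver
  ⊛-assoc-coeff f g h (suc n) = begin
    ((f ⊛ g) ⊛ h) (suc n)                                   ≡⟨ ⊛-coeff-suc (f ⊛ g) h n ⟩
    fg₀ ℤ.* h (suc n) ℤ.+ (tail (f ⊛ g) ⊛ h) n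
      ≡⟨ cong (ℤ._+_ (fg₀ ℤ.* h (suc n))) (coeff (⊛-cong (tail-⊛ f g) (≈-refl {h})) n) ⟩
    fg₀ ℤ.* h (suc n) ℤ.+ ((f 0 · tail g ⊕ tail f ⊛ g) ⊛ h) n
      ≡⟨ cong (ℤ._+_ (fg₀ ℤ.* h (suc n)))
              (trans (coeff (⊛-distribʳ-⊕ (f 0 · tail g) (tail f ⊛ g) h) n)
                     (cong₂ ℤ._+_ (coeff (·-⊛ (f 0) (tail g) h) n) (⊛-assoc-coeff (tail f) g h n))) ⟩
    fg₀ ℤ.* h (suc n) ℤ.+ (f 0 ℤ.* (tail g ⊛ h) n ℤ.+ (tail f ⊛ (g ⊛ h)) n)
      ≡⟨ solve 5 (λ a b c d e → (a :* b :+ con (+ 0)) :* c :+ (a :* d :+ e) := a :* (b :* c :+ d) :+ e)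
           refl (f 0) (g 0) (h (suc n)) ((tail g ⊛ h) n) ((tail f ⊛ (g ⊛ h)) n) ⟩
    f 0 ℤ.* (g 0 ℤ.* h (suc n) ℤ.+ (tail g ⊛ h) n) ℤ.+ (tail f ⊛ (g ⊛ h)) n
      ≡⟨ cong (λ x → f 0 ℤ.* x ℤ.+ (tail f ⊛ (g ⊛ h)) n) (sym (⊛-coeff-suc g h n)) ⟩
    f 0 ℤ.* (g ⊛ h) (suc n) ℤ.+ (tail f ⊛ (g ⊛ h)) n        ≡⟨ sym (⊛-coeff-suc f (g ⊛ h) n) ⟩
    (f ⊛ (g ⊛ h)) (suc n)                                   ∎
    where
    open +-*-Solver
    fg₀ = (f ⊛ g) 0

  const-⊛ : ∀ c f → const c ⊛ f ≈ c · f
  const-⊛ c f = coeffwise λ n → begin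
    (const c ⊛ f) n                               ≡⟨ ⊛-coeff (const c) f n ⟩
    c ℤ.* f n ℤ.+ ∑[ i < n ] (const c (suc i) ℤ.* f (n ∸ suc i))
      ≡⟨ cong (ℤ._+_ (c ℤ.* f n)) (∑-zero n (λ i _ → ℤ.*-zeroˡ (f (n ∸ suc i)))) ⟩
    c ℤ.* f n ℤ.+ + 0                             ≡⟨ ℤ.+-identityʳ (c ℤ.* f n) ⟩
    c ℤ.* f n                                     ∎

⊛-identityˡ : ∀ f → 𝟙 ⊛ f ≈ f
⊛-identityˡ f = coeffwise λ n → trans (coeff (const-⊛ (+ 1) f) n) (ℤ.*-identityˡ (f n))

⊛-identityʳ : ∀ f → f ⊛ 𝟙 ≈ f
⊛-identityʳ f = ≈-trans (⊛-comm f 𝟙) (⊛-identityˡ f)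

⊛-assoc : ∀ f g h → (f ⊛ g) ⊛ h ≈ f ⊛ (g ⊛ h)
⊛-assoc f g h = coeffwise (⊛-assoc-coeff f g h)

isCommutativeRing : IsCommutativeRing _≈_ _⊕_ _⊛_ ⊝_ 𝟘 𝟙
isCommutativeRing = record
  { isRing = record
    { +-isAbelianGroup = record
      { isGroup = record
        { isMonoid = record
          { isSemigroup = record
            { isMagma = record
              { isEquivalence = record { refl = ≈-refl ; sym = ≈-sym ; trans = ≈-trans }
              ; ∙-cong = λ f≈f′ g≈g′ → coeffwise λ n → cong₂ ℤ._+_ (coeff f≈f′ n) (coeff g≈g′ n) }
            ; assoc = λ f g h → coeffwise λ n → ℤ.+-assoc (f n) (g n) (h n) }
          ; identity = (λ f → coeffwise λ n → trans (cong (ℤ._+ f n) (const0≡0 n)) (ℤ.+-identityˡ (f n)))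
                     , (λ f → coeffwise λ n → trans (cong (ℤ._+_ (f n)) (const0≡0 n)) (ℤ.+-identityʳ (f n))) }
        ; inverse = (λ f → coeffwise λ n → trans (ℤ.+-inverseˡ (f n)) (sym (const0≡0 n)))
                  , (λ f → coeffwise λ n → trans (ℤ.+-inverseʳ (f n)) (sym (const0≡0 n)))
        ; ⁻¹-cong = λ f≈g → coeffwise λ n → cong -_ (coeff f≈g n) }
      ; comm = λ f g → coeffwise λ n → ℤ.+-comm (f n) (g n) }
    ; *-cong = ⊛-cong
    ; *-assoc = ⊛-assoc
    ; *-identity = ⊛-identityˡ , ⊛-identityʳ
    ; distrib = ⊛-distribˡ-⊕ , (λ h f g → ⊛-distribʳ-⊕ f g h) }
  ; *-comm = ⊛-comm }

commutativeRing : CommutativeRing _ _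
commutativeRing = record { isCommutativeRing = isCommutativeRing }

const-homomorphism : ℤ.+-*-rawRing -Raw-AlmostCommutative⟶ fromCommutativeRing commutativeRing
const-homomorphism = record
  { ⟦_⟧    = const
  ; +-homo = λ a b → coeffwise λ { zero → refl ; (suc n) → refl }
  ; *-homo = λ a b → coeffwise λ { zero → sym (coeff (const-⊛ a (const b)) 0)
                                 ; (suc n) → sym (trans (coeff (const-⊛ a (const b)) (suc n)) (ℤ.*-zeroʳ a)) }
  ; -‿homo = λ a → coeffwise λ { zero → refl ; (suc n) → refl }
  ; 0-homo = coeffwise λ _ → refl
  ; 1-homo = coeffwise λ _ → refl }

const≟ : ∀ a b → Maybe (const a ≈ const b)
const≟ a b with a ℤ.≟ b
... | yes refl = just ≈-refl
... | no  _    = nothing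

module PowerSeriesSolver =
  RingSolver ℤ.+-*-rawRing (fromCommutativeRing commutativeRing) const-homomorphism const≟
open PowerSeriesSolver using (solve; _:+_; _:*_; :-_; _:=_; con)

open CommutativeRing commutativeRing
  using (setoid; +-assoc; +-identityˡ; *-cong; +-cong; +-congˡ; +-congʳ; *-congˡ; *-congʳ; -‿cong)

X^-diag : ∀ m → X^ m m ≡ + 1
X^-diag m = cong (if_then + 1 else + 0) (trans (isYes≗does (m ℕ.≟ m)) (dec-true (m ℕ.≟ m) refl))

X^-off-diag : ∀ m n → n ≢ m → X^ m n ≡ + 0
X^-off-diag m n n≢m = cong (if_then + 1 else + 0) (trans (isYes≗does (n ℕ.≟ m)) (dec-false (n ℕ.≟ m) n≢m))

X^-suc-coeff : ∀ m n → X^ (suc m) (suc n) ≡ X^ m n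
X^-suc-coeff m n = by-cases m n (n ℕ.≟ m)
  where
  by-cases : ∀ m n → Dec (n ≡ m) → X^ (suc m) (suc n) ≡ X^ m n
  by-cases m _ (yes refl) = trans (X^-diag (suc m)) (sym (X^-diag m))
  by-cases m n (no n≢m)   = trans (X^-off-diag (suc m) (suc n) (n≢m ∘ ℕ.suc-injective)) (sym (X^-off-diag m n n≢m))

X^-zero : X^ 0 ≈ 𝟙
X^-zero = coeffwise λ { zero → refl ; (suc n) → refl }

≈-head-tail : ∀ {f g} → f 0 ≡ g 0 → tail f ≈ tail g → f ≈ g
≈-head-tail f₀≡g₀ _       .coeff zero    = f₀≡g₀
≈-head-tail _     tf≈tg   .coeff (suc n) = coeff tf≈tg n

X^-+ : ∀ a b → X^ (a + b) ≈ X^ a ⊛ X^ b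
X^-+ zero    b = begin
  X^ b           ≈⟨ ⊛-identityˡ (X^ b) ⟨
  𝟙 ⊛ X^ b       ≈⟨ *-congʳ {X^ b} X^-zero ⟨
  X^ 0 ⊛ X^ b    ∎
  where open SetoidReasoning setoid
X^-+ (suc a) b = ≈-head-tail (sym (ℤ.*-zeroˡ (X^ b 0))) (begin
  tail (X^ (suc a + b))                           ≈⟨ coeffwise (X^-suc-coeff (a + b)) ⟩
  X^ (a + b)                                      ≈⟨ X^-+ a b ⟩
  X^ a ⊛ X^ b                                     ≈⟨ +-identityˡ (X^ a ⊛ X^ b) ⟨
  𝟘 ⊕ X^ a ⊛ X^ b
    ≈⟨ +-congʳ {X^ a ⊛ X^ b} (coeffwise λ n → trans (ℤ.*-zeroˡ (X^ b (suc n))) (sym (const0≡0 n))) ⟨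
  (+ 0) · tail (X^ b) ⊕ X^ a ⊛ X^ b
    ≈⟨ +-congˡ {(+ 0) · tail (X^ b)} (*-congʳ {X^ b} (coeffwise (X^-suc-coeff a))) ⟨
  (+ 0) · tail (X^ b) ⊕ tail (X^ (suc a)) ⊛ X^ b  ≈⟨ tail-⊛ (X^ (suc a)) (X^ b) ⟨
  tail (X^ (suc a) ⊛ X^ b)                        ∎)
  where open SetoidReasoning setoid

X^-suc : ∀ j → X^ (suc j) ≈ X^ 1 ⊛ X^ j
X^-suc j = X^-+ 1 j

X^-double : ∀ j → X^ (2 * j) ≈ X^ j ⊛ X^ j
X^-double j = ≈-trans (cong≈ X^ (cong (_+_ j) (ℕ.+-identityʳ j))) (X^-+ j j)

infix 4 q^_∣_
q^_∣_ : ℕ → PS → Set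
q^ v ∣ f = ∀ n → n < v → f n ≡ + 0

q^-∣-X^ : ∀ v → q^ v ∣ X^ v
q^-∣-X^ v n n<v = X^-off-diag v n (ℕ.<⇒≢ n<v)

q^-∣-weaken : ∀ {v w f} → w ≤ v → q^ v ∣ f → q^ w ∣ f
q^-∣-weaken w≤v v∣f n n<w = v∣f n (ℕ.<-≤-trans n<w w≤v)

q^-∣-resp-≈ : ∀ {v f g} → f ≈ g → q^ v ∣ f → q^ v ∣ g
q^-∣-resp-≈ f≈g v∣f n n<v = trans (sym (coeff f≈g n)) (v∣f n n<v)

q^-∣-⊝ : ∀ {v f} → q^ v ∣ f → q^ v ∣ ⊝ f
q^-∣-⊝ v∣f n n<v = cong -_ (v∣f n n<v)

q^-∣-⊛ʳ : ∀ {v f} g → q^ v ∣ f → q^ v ∣ f ⊛ g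
q^-∣-⊛ʳ {f = f} g v∣f n n<v = trans (⊛-coeff f g n)
  (∑-zero (suc n) λ i i≤n → trans (cong (ℤ._* g (n ∸ i)) (v∣f i (ℕ.≤-<-trans (ℕ.≤-pred i≤n) n<v)))
                                   (ℤ.*-zeroˡ (g (n ∸ i))))

q^-∣-⊛ˡ : ∀ {v g} f → q^ v ∣ g → q^ v ∣ f ⊛ g
q^-∣-⊛ˡ {g = g} f v∣g = q^-∣-resp-≈ (⊛-comm g f) (q^-∣-⊛ʳ f v∣g)

q^-∣⇒⊕-≈[] : ∀ {v f} g → q^ suc v ∣ f → g ⊕ f ≈[ v ] g
q^-∣⇒⊕-≈[] g v∣f = coeffwise≤ λ n n≤v → trans (cong (ℤ._+_ (g n)) (v∣f n (s≤s n≤v))) (ℤ.+-identityʳ (g n))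

invList≡ : ∀ a n → invList a n ≡ applyUpTo (λ i → inv a (n ∸ i)) (suc n)
invList≡ a zero    = refl
invList≡ a (suc n) = cong (inv a (suc n) ∷_) (invList≡ a n)

zipWith-applyUpTo : ∀ {A B C : Set} (f : A → B → C) g h n →
                    zipWith f (applyUpTo g n) (applyUpTo h n) ≡ applyUpTo (λ i → f (g i) (h i)) n
zipWith-applyUpTo f g h zero    = refl
zipWith-applyUpTo f g h (suc n) = cong (f (g 0) (h 0) ∷_) (zipWith-applyUpTo f (g ∘ suc) (h ∘ suc) n)

inv-coeff-suc : ∀ a n → inv a (suc n) ≡ - (tail a ⊛ inv a) n
inv-coeff-suc a n = cong -_ (begin
  sum (zipWith ℤ._*_ (map (a ∘ suc) (upTo (length (invList a n)))) (invList a n))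
    ≡⟨ cong (λ bs → sum (zipWith ℤ._*_ (map (a ∘ suc) (upTo (length bs))) bs)) (invList≡ a n) ⟩
  sum (zipWith ℤ._*_ (map (a ∘ suc) (upTo (length bs))) bs)
    ≡⟨ cong (λ m → sum (zipWith ℤ._*_ (map (a ∘ suc) (upTo m)) bs))
            (length-applyUpTo (λ i → inv a (n ∸ i)) (suc n)) ⟩
  sum (zipWith ℤ._*_ (map (a ∘ suc) (upTo (suc n))) bs)
    ≡⟨ cong (λ as → sum (zipWith ℤ._*_ as bs)) (map-upTo (a ∘ suc) (suc n)) ⟩
  sum (zipWith ℤ._*_ (applyUpTo (a ∘ suc) (suc n)) bs)
    ≡⟨ cong sum (zipWith-applyUpTo ℤ._*_ (a ∘ suc) (λ i → inv a (n ∸ i)) (suc n)) ⟩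
  ∑[ i < suc n ] (a (suc i) ℤ.* inv a (n ∸ i))
    ≡⟨ ⊛-coeff (tail a) (inv a) n ⟨
  (tail a ⊛ inv a) n ∎)
  where
  open ≡-Reasoning
  bs = applyUpTo (λ i → inv a (n ∸ i)) (suc n)

⊛-inverseʳ : ∀ a → a 0 ≡ + 1 → a ⊛ inv a ≈ 𝟙
⊛-inverseʳ a a₀≡1 = ≈-head-tail (cong (λ c → c ℤ.* + 1 ℤ.+ + 0) a₀≡1) (coeffwise λ n → begin
  (a ⊛ inv a) (suc n)                                         ≡⟨ ⊛-coeff-suc a (inv a) n ⟩
  a 0 ℤ.* inv a (suc n) ℤ.+ (tail a ⊛ inv a) n
    ≡⟨ cong₂ (λ c b → c ℤ.* b ℤ.+ (tail a ⊛ inv a) n) a₀≡1 (inv-coeff-suc a n) ⟩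
  + 1 ℤ.* - (tail a ⊛ inv a) n ℤ.+ (tail a ⊛ inv a) n
    ≡⟨ cong (ℤ._+ (tail a ⊛ inv a) n) (ℤ.*-identityˡ (- (tail a ⊛ inv a) n)) ⟩
  - (tail a ⊛ inv a) n ℤ.+ (tail a ⊛ inv a) n                 ≡⟨ ℤ.+-inverseˡ ((tail a ⊛ inv a) n) ⟩
  + 0                                                         ∎)
  where open ≡-Reasoning

-- Infinite sums

-- Σ∞ cuts the sum over j off at the degree n, which is harmless exactly when q^j ∣ f j.
Summable : (ℕ → PS) → Set
Summable f = ∀ j → q^ j ∣ f j

Σ∞-cong-≈[] : ∀ {f g N} → (∀ j → f j ≈[ N ] g j) → Σ∞ f ≈[ N ] Σ∞ g
Σ∞-cong-≈[] {f} {g} f≈g = coeffwise≤ λ n n≤N → begin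
  Σ∞ f n                 ≡⟨ Σ∞-coeff f n ⟩
  ∑[ j < suc n ] f j n   ≡⟨ ∑-cong (suc n) (λ j → coeff≤ (f≈g j) n n≤N) ⟩
  ∑[ j < suc n ] g j n   ≡⟨ Σ∞-coeff g n ⟨
  Σ∞ g n                 ∎
  where open ≡-Reasoning

Σ∞-cong : ∀ {f g} → (∀ j → f j ≈ g j) → Σ∞ f ≈ Σ∞ g
Σ∞-cong f≈g = ≈[]-all⇒≈ λ N → Σ∞-cong-≈[] (λ j → ≈⇒≈[] N (f≈g j))

Σ∞-⊕ : ∀ f g → Σ∞ (λ j → f j ⊕ g j) ≈ Σ∞ f ⊕ Σ∞ g
Σ∞-⊕ f g = coeffwise λ n → begin
  Σ∞ (λ j → f j ⊕ g j) n                           ≡⟨ Σ∞-coeff (λ j → f j ⊕ g j) n ⟩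
  ∑[ j < suc n ] (f j n ℤ.+ g j n)                 ≡⟨ ∑-distrib-+ (suc n) (λ j → f j n) (λ j → g j n) ⟩
  ∑[ j < suc n ] f j n ℤ.+ ∑[ j < suc n ] g j n    ≡⟨ cong₂ ℤ._+_ (Σ∞-coeff f n) (Σ∞-coeff g n) ⟨
  Σ∞ f n ℤ.+ Σ∞ g n                                ∎
  where open ≡-Reasoning

Σ∞-⊝ : ∀ f → Σ∞ (λ j → ⊝ f j) ≈ ⊝ Σ∞ f
Σ∞-⊝ f = coeffwise λ n → begin
  Σ∞ (λ j → ⊝ f j) n        ≡⟨ Σ∞-coeff (λ j → ⊝ f j) n ⟩
  ∑[ j < suc n ] (- f j n)  ≡⟨ neg-distrib-∑ (suc n) (λ j → f j n) ⟨
  - ∑[ j < suc n ] f j n    ≡⟨ cong -_ (Σ∞-coeff f n) ⟨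
  - Σ∞ f n                  ∎
  where open ≡-Reasoning

Σ∞-uncons : ∀ {f} → Summable f → Σ∞ f ≈ f 0 ⊕ Σ∞ (f ∘ suc)
Σ∞-uncons {f} summable = coeffwise λ n → begin
  Σ∞ f n                                          ≡⟨ Σ∞-coeff f n ⟩
  f 0 n ℤ.+ ∑[ j < n ] f (suc j) n
    ≡⟨ cong (ℤ._+_ (f 0 n)) (∑-extend n (suc n) (λ j → f (suc j) n) (ℕ.n≤1+n n)
                                       (λ j n≤j → summable (suc j) n (s≤s n≤j))) ⟨
  f 0 n ℤ.+ ∑[ j < suc n ] f (suc j) n            ≡⟨ cong (ℤ._+_ (f 0 n)) (Σ∞-coeff (f ∘ suc) n) ⟨
  f 0 n ℤ.+ Σ∞ (f ∘ suc) n                        ∎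
  where open ≡-Reasoning

⊛-Σ∞ : ∀ h {f} → Summable f → h ⊛ Σ∞ f ≈ Σ∞ (λ j → h ⊛ f j)
⊛-Σ∞ h {f} summable .coeff n = begin
  (h ⊛ Σ∞ f) n                                                  ≡⟨ ⊛-coeff h (Σ∞ f) n ⟩
  ∑[ i < suc n ] (h i ℤ.* Σ∞ f (n ∸ i))
    ≡⟨ ∑-cong-< (suc n) (λ i i≤n → cong (h i ℤ.*_) (Σ∞-coeff-extended i i≤n)) ⟩
  ∑[ i < suc n ] (h i ℤ.* ∑[ j < suc n ] f j (n ∸ i))
    ≡⟨ ∑-cong (suc n) (λ i → *-distribˡ-∑ (suc n) (h i) (λ j → f j (n ∸ i))) ⟩
  ∑[ i < suc n ] ∑[ j < suc n ] (h i ℤ.* f j (n ∸ i))          ≡⟨ ∑-comm (suc n) (suc n) (λ i j → h i ℤ.* f j (n ∸ i)) ⟩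
  ∑[ j < suc n ] ∑[ i < suc n ] (h i ℤ.* f j (n ∸ i))          ≡⟨ ∑-cong (suc n) (λ j → ⊛-coeff h (f j) n) ⟨
  ∑[ j < suc n ] (h ⊛ f j) n                                    ≡⟨ Σ∞-coeff (λ j → h ⊛ f j) n ⟨
  Σ∞ (λ j → h ⊛ f j) n                                          ∎
  where
  open ≡-Reasoning
  Σ∞-coeff-extended : ∀ i → i < suc n → Σ∞ f (n ∸ i) ≡ ∑[ j < suc n ] f j (n ∸ i)
  Σ∞-coeff-extended i i≤n = trans (Σ∞-coeff f (n ∸ i)) (sym
    (∑-extend (suc (n ∸ i)) (suc n) (λ j → f j (n ∸ i)) (s≤s (ℕ.m∸n≤m n i))
              (λ j n∸i<j → summable j (n ∸ i) n∸i<j)))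

-- q-Pochhammer products

1-X^ : ℕ → PS
1-X^ r = 𝟙 ⊕ ⊝ X^ r

-- qqFrom a l = (q^(1+a);q)_l
qqFrom : ℕ → ℕ → PS
qqFrom a zero    = 𝟙
qqFrom a (suc l) = qqFrom a l ⊛ 1-X^ (a + suc l)

-- (q^(1+a);q)_∞, truncated as qqInf is: factors 1 - q^r with r > n do not affect degree n.
qqInfFrom : ℕ → PS
qqInfFrom a n = qqFrom a n n

qq≡qqFrom : ∀ m → qq m ≡ qqFrom 0 m
qq≡qqFrom zero    = refl
qq≡qqFrom (suc m) = cong (_⊛ 1-X^ (suc m)) (qq≡qqFrom m)

⊛-1-X^-≈[] : ∀ f {r N} → N < r → f ⊛ 1-X^ r ≈[ N ] f
⊛-1-X^-≈[] f {r} {N} N<r = begin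
  f ⊛ 1-X^ r                ≈⟨ ≈⇒≈[] N (solve 2 (λ f x → f :* (con (+ 1) :+ :- x) := f :+ :- x :* f) ≈-refl f (X^ r)) ⟩
  f ⊕ (⊝ X^ r) ⊛ f          ≈⟨ q^-∣⇒⊕-≈[] f (q^-∣-weaken N<r (q^-∣-⊛ʳ f (q^-∣-⊝ (q^-∣-X^ r)))) ⟩
  f                         ∎
  where open SetoidReasoning (≈[]-setoid N)

qqFrom-+ : ∀ a j l → qqFrom a (j + l) ≈ qqFrom a j ⊛ qqFrom (a + j) l
qqFrom-+ a j zero    rewrite ℕ.+-identityʳ j = ≈-sym (⊛-identityʳ (qqFrom a j))
qqFrom-+ a j (suc l) rewrite ℕ.+-suc j l = begin
  qqFrom a (j + l) ⊛ 1-X^ (a + suc (j + l))                   ≈⟨ *-cong (qqFrom-+ a j l) (cong≈ 1-X^ a+[1+j+l]) ⟩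
  qqFrom a j ⊛ qqFrom (a + j) l ⊛ 1-X^ (a + j + suc l)        ≈⟨ ⊛-assoc (qqFrom a j) (qqFrom (a + j) l) _ ⟩
  qqFrom a j ⊛ qqFrom (a + j) (suc l)                         ∎
  where
  open SetoidReasoning setoid
  a+[1+j+l] : a + suc (j + l) ≡ a + j + suc l
  a+[1+j+l] = trans (cong (_+_ a) (sym (ℕ.+-suc j l))) (sym (ℕ.+-assoc a j (suc l)))

qqFrom-≈[]-𝟙 : ∀ a l → qqFrom a l ≈[ a ] 𝟙
qqFrom-≈[]-𝟙 a zero    = ≈[]-refl
qqFrom-≈[]-𝟙 a (suc l) =
  ≈[]-trans (⊛-1-X^-≈[] (qqFrom a l) (ℕ.m<m+n a (s≤s z≤n))) (qqFrom-≈[]-𝟙 a l)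

qqFrom-stable : ∀ a l d → qqFrom a (l + d) ≈[ l ] qqFrom a l
qqFrom-stable a l d = begin
  qqFrom a (l + d)                    ≈⟨ ≈⇒≈[] l (qqFrom-+ a l d) ⟩
  qqFrom a l ⊛ qqFrom (a + l) d
    ≈⟨ ⊛-cong-≈[] (≈[]-refl {qqFrom a l}) (≈[]-weaken (ℕ.m≤n+m l a) (qqFrom-≈[]-𝟙 (a + l) d)) ⟩
  qqFrom a l ⊛ 𝟙                      ≈⟨ ≈⇒≈[] l (⊛-identityʳ (qqFrom a l)) ⟩
  qqFrom a l                          ∎
  where open SetoidReasoning (≈[]-setoid l)

qqInfFrom-≈[]-qqFrom : ∀ a l → qqInfFrom a ≈[ l ] qqFrom a l
qqInfFrom-≈[]-qqFrom a l = coeffwise≤ λ n n≤l → begin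
  qqFrom a n n                ≡⟨ coeff≤ (qqFrom-stable a n (l ∸ n)) n ℕ.≤-refl ⟨
  qqFrom a (n + (l ∸ n)) n    ≡⟨ cong (λ m → qqFrom a m n) (ℕ.m+[n∸m]≡n n≤l) ⟩
  qqFrom a l n                ∎
  where open ≡-Reasoning

qqInfFrom-≈[]-𝟙 : ∀ a → qqInfFrom a ≈[ a ] 𝟙
qqInfFrom-≈[]-𝟙 a = ≈[]-trans (qqInfFrom-≈[]-qqFrom a a) (qqFrom-≈[]-𝟙 a a)

qqInfFrom-peel : ∀ a → qqInfFrom a ≈ 1-X^ (suc a) ⊛ qqInfFrom (suc a)
qqInfFrom-peel a = ≈[]-all⇒≈ agree
  where
  a+1≡1+a = ℕ.+-comm a 1
  agree : ∀ N → qqInfFrom a ≈[ N ] 1-X^ (suc a) ⊛ qqInfFrom (suc a)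
  agree N = begin
    qqInfFrom a                                  ≈⟨ ≈[]-weaken (ℕ.n≤1+n N) (qqInfFrom-≈[]-qqFrom a (suc N)) ⟩
    qqFrom a (1 + N)                             ≈⟨ ≈⇒≈[] N (qqFrom-+ a 1 N) ⟩
    𝟙 ⊛ 1-X^ (a + 1) ⊛ qqFrom (a + 1) N
      ≈⟨ ≈⇒≈[] N (*-cong (≈-trans (⊛-identityˡ _) (cong≈ 1-X^ a+1≡1+a)) (cong≈ (λ b → qqFrom b N) a+1≡1+a)) ⟩
    1-X^ (suc a) ⊛ qqFrom (suc a) N
      ≈⟨ ⊛-cong-≈[] (≈[]-refl {1-X^ (suc a)}) (qqInfFrom-≈[]-qqFrom (suc a) N) ⟨
    1-X^ (suc a) ⊛ qqInfFrom (suc a)             ∎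
    where open SetoidReasoning (≈[]-setoid N)

qqInf-split : ∀ j → qqInf ≈ qq j ⊛ qqInfFrom j
qqInf-split j = ≈[]-all⇒≈ agree
  where
  agree : ∀ N → qqInf ≈[ N ] qq j ⊛ qqInfFrom j
  agree N = begin
    qqInf                            ≈⟨ ≈⇒≈[] N (coeffwise λ n → cong (λ p → p n) (qq≡qqFrom n)) ⟩
    qqInfFrom 0                      ≈⟨ ≈[]-weaken (ℕ.m≤n+m N j) (qqInfFrom-≈[]-qqFrom 0 (j + N)) ⟩
    qqFrom 0 (j + N)                 ≈⟨ ≈⇒≈[] N (qqFrom-+ 0 j N) ⟩
    qqFrom 0 j ⊛ qqFrom j N
      ≈⟨ ⊛-cong-≈[] (≈⇒≈[] N (cong≈ id (sym (qq≡qqFrom j)))) (≈[]-sym (qqInfFrom-≈[]-qqFrom j N)) ⟩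
    qq j ⊛ qqInfFrom j               ∎
    where open SetoidReasoning (≈[]-setoid N)

telescope : ∀ M n → ∑[ j < suc M ] (X^ j ⊛ qqInfFrom j) n ≡ qqInfFrom M n
telescope zero n = trans (ℤ.+-identityʳ ((X^ 0 ⊛ qqInfFrom 0) n))
  (coeff (≈-trans (*-congʳ {qqInfFrom 0} X^-zero) (⊛-identityˡ (qqInfFrom 0))) n)
telescope (suc M) n = begin
  ∑[ j < suc (suc M) ] (X^ j ⊛ qqInfFrom j) n                   ≡⟨ ∑-snoc (suc M) (λ j → (X^ j ⊛ qqInfFrom j) n) ⟩
  ∑[ j < suc M ] (X^ j ⊛ qqInfFrom j) n ℤ.+ (z ⊛ t) n          ≡⟨ cong (ℤ._+ (z ⊛ t) n) (telescope M n) ⟩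
  qqInfFrom M n ℤ.+ (z ⊛ t) n                                   ≡⟨ cong (ℤ._+ (z ⊛ t) n) (coeff (qqInfFrom-peel M) n) ⟩
  ((𝟙 ⊕ ⊝ z) ⊛ t ⊕ z ⊛ t) n
    ≡⟨ coeff (solve 2 (λ z t → (con (+ 1) :+ :- z) :* t :+ z :* t := t) ≈-refl z t) n ⟩
  t n                                                           ∎
  where
  open ≡-Reasoning
  z = X^ (suc M)
  t = qqInfFrom (suc M)

Σ∞-X^⊛qqInfFrom : Σ∞ (λ j → X^ j ⊛ qqInfFrom j) ≈ 𝟙
Σ∞-X^⊛qqInfFrom = coeffwise λ n →
  trans (Σ∞-coeff (λ j → X^ j ⊛ qqInfFrom j) n)
        (trans (telescope n n) (coeff≤ (qqInfFrom-≈[]-𝟙 n) n ℕ.≤-refl))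

-- The three-term recurrence

Recurrence : (ℕ → PS) → Set
Recurrence G = ∀ k → G k ≈ 1-X^ (suc k) ⊛ G (suc k) ⊕ X^ (suc (suc k)) ⊛ G (suc (suc k))

recurrence-unique : ∀ {G H} → Recurrence G → Recurrence H → (∀ k → G k ≈[ k ] H k) → ∀ k → G k ≈ H k
recurrence-unique {G} {H} recG recH G≈H k = ≈[]-all⇒≈ λ N → ≈[]-weaken (ℕ.m≤m+n N k) (agree N k)
  where
  agree : ∀ v k → G k ≈[ v + k ] H k
  agree zero    k = G≈H k
  agree (suc v) k = begin
    G k                                                            ≈⟨ ≈⇒≈[] _ (recG k) ⟩
    1-X^ (suc k) ⊛ G (suc k) ⊕ X^ (suc (suc k)) ⊛ G (suc (suc k))
      ≈⟨ ⊕-cong-≈[] (⊛-cong-≈[] (≈[]-refl {1-X^ (suc k)}) (≈[]-weaken 1+v+k≤v+[1+k] (agree v (suc k))))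
                    (⊛-cong-≈[] (≈[]-refl {X^ (suc (suc k))}) (≈[]-weaken 1+v+k≤v+[2+k] (agree v (suc (suc k))))) ⟩
    1-X^ (suc k) ⊛ H (suc k) ⊕ X^ (suc (suc k)) ⊛ H (suc (suc k))  ≈⟨ ≈⇒≈[] _ (recH k) ⟨
    H k                                                            ∎
    where
    open SetoidReasoning (≈[]-setoid (suc v + k))
    1+v+k≤v+[1+k] : suc v + k ≤ v + suc k
    1+v+k≤v+[1+k] = ℕ.≤-reflexive (sym (ℕ.+-suc v k))
    1+v+k≤v+[2+k] : suc v + k ≤ v + suc (suc k)
    1+v+k≤v+[2+k] = ℕ.≤-trans 1+v+k≤v+[1+k] (ℕ.+-monoʳ-≤ v (ℕ.n≤1+n (suc k)))

-- The series U and V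

U-term V-term : ℕ → ℕ → PS
U-term k j = X^ j ⊛ qqInfFrom j ⊛ qqInfFrom (j + k)
V-term k j = X^ (2 * j) ⊛ qqInfFrom j ⊛ qqInfFrom (j + k)

U V : ℕ → PS
U k = Σ∞ (U-term k)
V k = Σ∞ (V-term k)

U-summable : ∀ k → Summable (U-term k)
U-summable k j = q^-∣-⊛ʳ _ (q^-∣-⊛ʳ _ (q^-∣-X^ j))

V-summable : ∀ k → Summable (V-term k)
V-summable k j = q^-∣-⊛ʳ _ (q^-∣-⊛ʳ _ (q^-∣-weaken (ℕ.m≤m+n j (j + 0)) (q^-∣-X^ (2 * j))))

U-term-suc : ∀ k j → U-term k (suc j) ≈ V-term k (suc j) ⊕ X^ 1 ⊛ U-term (suc k) j
U-term-suc k j = begin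
  X^ (suc j) ⊛ t ⊛ t′                                          ≈⟨ *-congʳ {t′} (*-congʳ {t} (X^-suc j)) ⟩
  x ⊛ y ⊛ t ⊛ t′
    ≈⟨ solve 4 (λ x y t t′ → x :* y :* t :* t′ :=
                 (x :* y) :* (x :* y) :* t :* t′ :+ x :* (y :* ((con (+ 1) :+ :- (x :* y)) :* t) :* t′))
             ≈-refl x y t t′ ⟩
  (x ⊛ y) ⊛ (x ⊛ y) ⊛ t ⊛ t′ ⊕ x ⊛ (y ⊛ ((𝟙 ⊕ ⊝ (x ⊛ y)) ⊛ t) ⊛ t′)
    ≈⟨ +-cong (*-congʳ {t′} (*-congʳ {t} X^[2+2j]≈))
              (*-congˡ {x} (*-cong (*-congˡ {y} peel) (cong≈ qqInfFrom (ℕ.+-suc j k)))) ⟨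
  V-term k (suc j) ⊕ x ⊛ U-term (suc k) j                      ∎
  where
  open SetoidReasoning setoid
  x = X^ 1
  y = X^ j
  t = qqInfFrom (suc j)
  t′ = qqInfFrom (suc j + k)
  X^[2+2j]≈ : X^ (2 * suc j) ≈ (x ⊛ y) ⊛ (x ⊛ y)
  X^[2+2j]≈ = ≈-trans (X^-double (suc j)) (*-cong (X^-suc j) (X^-suc j))
  peel : qqInfFrom j ≈ (𝟙 ⊕ ⊝ (x ⊛ y)) ⊛ t
  peel = ≈-trans (qqInfFrom-peel j) (*-congʳ {t} (+-congˡ {𝟙} (-‿cong (X^-suc j))))

U-term≈ : ∀ k j → U-term k j ≈ U-term (suc k) j ⊕ ⊝ (X^ (suc k) ⊛ V-term (suc k) j)
U-term≈ k j = begin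
  y ⊛ t ⊛ qqInfFrom (j + k)                                     ≈⟨ *-congˡ {y ⊛ t} peel ⟩
  y ⊛ t ⊛ ((𝟙 ⊕ ⊝ (z ⊛ y)) ⊛ u)
    ≈⟨ solve 4 (λ y t z u → y :* t :* ((con (+ 1) :+ :- (z :* y)) :* u) := y :* t :* u :+ :- (z :* ((y :* y) :* t :* u)))
             ≈-refl y t z u ⟩
  y ⊛ t ⊛ u ⊕ ⊝ (z ⊛ ((y ⊛ y) ⊛ t ⊛ u))
    ≈⟨ +-cong (*-congˡ {y ⊛ t} u≈) (-‿cong (*-congˡ {z} (*-cong (*-congʳ {t} (X^-double j)) u≈))) ⟨
  U-term (suc k) j ⊕ ⊝ (z ⊛ V-term (suc k) j)                   ∎
  where
  open SetoidReasoning setoid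
  y = X^ j
  t = qqInfFrom j
  z = X^ (suc k)
  u = qqInfFrom (suc (j + k))
  u≈ : qqInfFrom (j + suc k) ≈ u
  u≈ = cong≈ qqInfFrom (ℕ.+-suc j k)
  X^[1+j+k]≈ : X^ (suc (j + k)) ≈ z ⊛ y
  X^[1+j+k]≈ = ≈-trans (cong≈ X^ (cong suc (ℕ.+-comm j k))) (X^-+ (suc k) j)
  peel : qqInfFrom (j + k) ≈ (𝟙 ⊕ ⊝ (z ⊛ y)) ⊛ u
  peel = ≈-trans (qqInfFrom-peel (j + k)) (*-congʳ {u} (+-congˡ {𝟙} (-‿cong X^[1+j+k]≈)))

U≈V+qU : ∀ k → U k ≈ V k ⊕ X^ 1 ⊛ U (suc k)
U≈V+qU k = begin
  U k                                                                  ≈⟨ Σ∞-uncons (U-summable k) ⟩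
  U-term k 0 ⊕ Σ∞ (U-term k ∘ suc)
    ≈⟨ +-congˡ {U-term k 0} (Σ∞-cong (U-term-suc k)) ⟩
  U-term k 0 ⊕ Σ∞ (λ j → V-term k (suc j) ⊕ X^ 1 ⊛ U-term (suc k) j)
    ≈⟨ +-congˡ {U-term k 0} (Σ∞-⊕ (V-term k ∘ suc) (λ j → X^ 1 ⊛ U-term (suc k) j)) ⟩
  U-term k 0 ⊕ (Σ∞ (V-term k ∘ suc) ⊕ Σ∞ (λ j → X^ 1 ⊛ U-term (suc k) j))
    ≈⟨ +-congˡ {U-term k 0} (+-congˡ {Σ∞ (V-term k ∘ suc)} (⊛-Σ∞ (X^ 1) (U-summable (suc k)))) ⟨
  V-term k 0 ⊕ (Σ∞ (V-term k ∘ suc) ⊕ X^ 1 ⊛ U (suc k))               ≈⟨ +-assoc (V-term k 0) _ _ ⟨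
  V-term k 0 ⊕ Σ∞ (V-term k ∘ suc) ⊕ X^ 1 ⊛ U (suc k)
    ≈⟨ +-congʳ {X^ 1 ⊛ U (suc k)} (Σ∞-uncons (V-summable k)) ⟨
  V k ⊕ X^ 1 ⊛ U (suc k)                                               ∎
  where open SetoidReasoning setoid

V≈U-qU : ∀ k → V k ≈ U k ⊕ ⊝ (X^ 1 ⊛ U (suc k))
V≈U-qU k = begin
  V k                                         ≈⟨ solve 2 (λ v w → v := v :+ w :+ :- w) ≈-refl (V k) (X^ 1 ⊛ U (suc k)) ⟩
  V k ⊕ X^ 1 ⊛ U (suc k) ⊕ ⊝ (X^ 1 ⊛ U (suc k))  ≈⟨ +-congʳ {⊝ (X^ 1 ⊛ U (suc k))} (U≈V+qU k) ⟨
  U k ⊕ ⊝ (X^ 1 ⊛ U (suc k))                  ∎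
  where open SetoidReasoning setoid

U≈U-qV : ∀ k → U k ≈ U (suc k) ⊕ ⊝ (X^ (suc k) ⊛ V (suc k))
U≈U-qV k = begin
  U k                                                                  ≈⟨ Σ∞-cong (U-term≈ k) ⟩
  Σ∞ (λ j → U-term (suc k) j ⊕ ⊝ (X^ (suc k) ⊛ V-term (suc k) j))
    ≈⟨ Σ∞-⊕ (U-term (suc k)) (λ j → ⊝ (X^ (suc k) ⊛ V-term (suc k) j)) ⟩
  U (suc k) ⊕ Σ∞ (λ j → ⊝ (X^ (suc k) ⊛ V-term (suc k) j))
    ≈⟨ +-congˡ {U (suc k)} (Σ∞-⊝ (λ j → X^ (suc k) ⊛ V-term (suc k) j)) ⟩
  U (suc k) ⊕ ⊝ Σ∞ (λ j → X^ (suc k) ⊛ V-term (suc k) j)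
    ≈⟨ +-congˡ {U (suc k)} (-‿cong (⊛-Σ∞ (X^ (suc k)) (V-summable (suc k)))) ⟨
  U (suc k) ⊕ ⊝ (X^ (suc k) ⊛ V (suc k))                               ∎
  where open SetoidReasoning setoid

U-recurrence : Recurrence U
U-recurrence k = begin
  U k                                                    ≈⟨ U≈U-qV k ⟩
  U₁ ⊕ ⊝ (z ⊛ V (suc k))                                 ≈⟨ +-congˡ {U₁} (-‿cong (*-congˡ {z} (V≈U-qU (suc k)))) ⟩
  U₁ ⊕ ⊝ (z ⊛ (U₁ ⊕ ⊝ (x ⊛ U₂)))
    ≈⟨ solve 4 (λ u₁ u₂ x z → u₁ :+ :- (z :* (u₁ :+ :- (x :* u₂))) := (con (+ 1) :+ :- z) :* u₁ :+ (x :* z) :* u₂)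
             ≈-refl U₁ U₂ x z ⟩
  1-X^ (suc k) ⊛ U₁ ⊕ (x ⊛ z) ⊛ U₂
    ≈⟨ +-congˡ {1-X^ (suc k) ⊛ U₁} (*-congʳ {U₂} (X^-suc (suc k))) ⟨
  1-X^ (suc k) ⊛ U₁ ⊕ X^ (suc (suc k)) ⊛ U₂              ∎
  where
  open SetoidReasoning setoid
  U₁ = U (suc k)
  U₂ = U (suc (suc k))
  x = X^ 1
  z = X^ (suc k)

U≈[]𝟙 : ∀ k → U k ≈[ k ] 𝟙
U≈[]𝟙 k = begin
  U k                                   ≈⟨ Σ∞-cong-≈[] drop-last-factor ⟩
  Σ∞ (λ j → X^ j ⊛ qqInfFrom j)         ≈⟨ ≈⇒≈[] k Σ∞-X^⊛qqInfFrom ⟩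
  𝟙                                     ∎
  where
  open SetoidReasoning (≈[]-setoid k)
  drop-last-factor : ∀ j → U-term k j ≈[ k ] X^ j ⊛ qqInfFrom j
  drop-last-factor j = ≈[]-trans
    (⊛-cong-≈[] (≈[]-refl {X^ j ⊛ qqInfFrom j}) (≈[]-weaken (ℕ.m≤n+m k j) (qqInfFrom-≈[]-𝟙 (j + k))))
    (≈⇒≈[] k (⊛-identityʳ (X^ j ⊛ qqInfFrom j)))

-- The partial theta series

tri-suc : ∀ j → tri (suc j) ≡ tri j + suc j
tri-suc j = begin
  (suc j * (suc j + 1)) / 2           ≡⟨ cong (_/ 2) [1+j][2+j]≡ ⟩
  (j * (j + 1) + suc j * 2) / 2       ≡⟨ +-distrib-/-∣ʳ (j * (j + 1)) (divides (suc j) refl) ⟩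
  tri j + (suc j * 2) / 2             ≡⟨ cong (_+_ (tri j)) (m*n/n≡m (suc j) 2) ⟩
  tri j + suc j                       ∎
  where
  open ≡-Reasoning
  [1+j][2+j]≡ : suc j * (suc j + 1) ≡ j * (j + 1) + suc j * 2
  [1+j][2+j]≡ = expand j
    where
    expand : ∀ j → suc j * (suc j + 1) ≡ j * (j + 1) + suc j * 2
    expand = solve-∀

θ-degree : ℕ → ℕ → ℕ
θ-degree k i = i * k + tri i

tri-+ : ∀ k i → tri (k + i) ≡ tri k + θ-degree k i
tri-+ k zero    = trans (cong tri (ℕ.+-identityʳ k)) (sym (ℕ.+-identityʳ (tri k)))
tri-+ k (suc i) = begin
  tri (k + suc i)                          ≡⟨ cong tri (ℕ.+-suc k i) ⟩
  tri (suc (k + i))                        ≡⟨ tri-suc (k + i) ⟩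
  tri (k + i) + suc (k + i)                ≡⟨ cong (_+ suc (k + i)) (tri-+ k i) ⟩
  tri k + (i * k + tri i) + suc (k + i)    ≡⟨ rearrange (tri k) (tri i) i k ⟩
  tri k + (suc i * k + (tri i + suc i))    ≡⟨ cong (λ t → tri k + (suc i * k + t)) (tri-suc i) ⟨
  tri k + θ-degree k (suc i)               ∎
  where
  open ≡-Reasoning
  rearrange : ∀ a b i k → a + (i * k + b) + suc (k + i) ≡ a + (suc i * k + (b + suc i))
  rearrange = solve-∀

θ-degree-suc : ∀ k i → θ-degree k (suc i) ≡ suc k + θ-degree (suc k) i
θ-degree-suc k i = trans (cong (_+_ (suc i * k)) (tri-suc i)) (rearrange (tri i) i k)
  where
  rearrange : ∀ b i k → suc i * k + (b + suc i) ≡ suc k + (i * suc k + b)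
  rearrange = solve-∀

i≤tri-i : ∀ i → i ≤ tri i
i≤tri-i zero    = z≤n
i≤tri-i (suc i) = ℕ.≤-trans (ℕ.m≤n+m (suc i) (tri i)) (ℕ.≤-reflexive (sym (tri-suc i)))

θ-term : ℕ → ℕ → PS
θ-term k i = const (sgn ((k + i) ∸ k)) ⊛ X^ (tri (k + i) ∸ tri k)

S : ℕ → PS
S k = Σ∞ (θ-term k)

θ-term≈ : ∀ k i → θ-term k i ≈ const (sgn i) ⊛ X^ (θ-degree k i)
θ-term≈ k i = cong≈ (λ (s , d) → const (sgn s) ⊛ X^ d)
  (cong₂ _,_ (ℕ.m+n∸m≡n k i) (trans (cong (_∸ tri k) (tri-+ k i)) (ℕ.m+n∸m≡n (tri k) (θ-degree k i))))

S-summable : ∀ k → Summable (θ-term k)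
S-summable k i = q^-∣-resp-≈ (≈-sym (θ-term≈ k i))
  (q^-∣-⊛ˡ (const (sgn i)) (q^-∣-weaken i≤θ-degree (q^-∣-X^ (θ-degree k i))))
  where
  i≤θ-degree : i ≤ θ-degree k i
  i≤θ-degree = ℕ.≤-trans (i≤tri-i i) (ℕ.m≤n+m (tri i) (i * k))

θ-term-zero : ∀ k → θ-term k 0 ≈ 𝟙
θ-term-zero k = ≈-trans (θ-term≈ k 0) (≈-trans (⊛-identityˡ (X^ 0)) X^-zero)

const-neg : ∀ c → const (- c) ≈ ⊝ const c
const-neg c = coeffwise λ { zero → refl ; (suc n) → refl }

θ-term-suc : ∀ k i → θ-term k (suc i) ≈ ⊝ (X^ (suc k) ⊛ θ-term (suc k) i)
θ-term-suc k i = begin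
  θ-term k (suc i)                          ≈⟨ θ-term≈ k (suc i) ⟩
  const (- sgn i) ⊛ X^ (θ-degree k (suc i))
    ≈⟨ *-cong (const-neg (sgn i)) (≈-trans (cong≈ X^ (θ-degree-suc k i)) (X^-+ (suc k) (θ-degree (suc k) i))) ⟩
  ⊝ c ⊛ (z ⊛ w)                             ≈⟨ solve 3 (λ c z w → :- c :* (z :* w) := :- (z :* (c :* w))) ≈-refl c z w ⟩
  ⊝ (z ⊛ (c ⊛ w))                           ≈⟨ -‿cong (*-congˡ {z} (θ-term≈ (suc k) i)) ⟨
  ⊝ (z ⊛ θ-term (suc k) i)                  ∎
  where
  open SetoidReasoning setoid
  c = const (sgn i)
  z = X^ (suc k)
  w = X^ (θ-degree (suc k) i)

S≈1-qS : ∀ k → S k ≈ 𝟙 ⊕ ⊝ (X^ (suc k) ⊛ S (suc k))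
S≈1-qS k = begin
  S k                                                     ≈⟨ Σ∞-uncons (S-summable k) ⟩
  θ-term k 0 ⊕ Σ∞ (θ-term k ∘ suc)                        ≈⟨ +-cong (θ-term-zero k) (Σ∞-cong (θ-term-suc k)) ⟩
  𝟙 ⊕ Σ∞ (λ i → ⊝ (X^ (suc k) ⊛ θ-term (suc k) i))        ≈⟨ +-congˡ {𝟙} (Σ∞-⊝ (λ i → X^ (suc k) ⊛ θ-term (suc k) i)) ⟩
  𝟙 ⊕ ⊝ Σ∞ (λ i → X^ (suc k) ⊛ θ-term (suc k) i)
    ≈⟨ +-congˡ {𝟙} (-‿cong (⊛-Σ∞ (X^ (suc k)) (S-summable (suc k)))) ⟨
  𝟙 ⊕ ⊝ (X^ (suc k) ⊛ S (suc k))                          ∎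
  where open SetoidReasoning setoid

𝟙⊕⊝-flip : ∀ {f g} → f ≈ 𝟙 ⊕ ⊝ g → g ≈ 𝟙 ⊕ ⊝ f
𝟙⊕⊝-flip {f} {g} f≈1-g = begin
  g                    ≈⟨ solve 1 (λ g → g := con (+ 1) :+ :- (con (+ 1) :+ :- g)) ≈-refl g ⟩
  𝟙 ⊕ ⊝ (𝟙 ⊕ ⊝ g)      ≈⟨ +-congˡ {𝟙} (-‿cong f≈1-g) ⟨
  𝟙 ⊕ ⊝ f              ∎
  where open SetoidReasoning setoid

S-recurrence : Recurrence S
S-recurrence k = begin
  S k                                       ≈⟨ S≈1-qS k ⟩
  𝟙 ⊕ ⊝ (z ⊛ S₁)
    ≈⟨ solve 2 (λ z s → con (+ 1) :+ :- (z :* s) := (con (+ 1) :+ :- z) :* s :+ (con (+ 1) :+ :- s)) ≈-refl z S₁ ⟩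
  1-X^ (suc k) ⊛ S₁ ⊕ (𝟙 ⊕ ⊝ S₁)            ≈⟨ +-congˡ {1-X^ (suc k) ⊛ S₁} (𝟙⊕⊝-flip (S≈1-qS (suc k))) ⟨
  1-X^ (suc k) ⊛ S₁ ⊕ X^ (suc (suc k)) ⊛ S (suc (suc k)) ∎
  where
  open SetoidReasoning setoid
  z = X^ (suc k)
  S₁ = S (suc k)

S≈[]𝟙 : ∀ k → S k ≈[ k ] 𝟙
S≈[]𝟙 k = ≈[]-trans (≈⇒≈[] k (S≈1-qS k))
  (q^-∣⇒⊕-≈[] 𝟙 (q^-∣-⊝ (q^-∣-⊛ʳ (S (suc k)) (q^-∣-X^ (suc k)))))

L-term : ℕ → ℕ → PS
L-term k j = X^ (2 * j + k) ⊛ inv (qq j) ⊛ inv (qq (j + k))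

L-summable : ∀ k → Summable (L-term k)
L-summable k j = q^-∣-⊛ʳ _ (q^-∣-⊛ʳ _ (q^-∣-weaken j≤2j+k (q^-∣-X^ (2 * j + k))))
  where
  j≤2j+k : j ≤ 2 * j + k
  j≤2j+k = ℕ.≤-trans (ℕ.m≤m+n j (j + 0)) (ℕ.m≤m+n (2 * j) k)

qq0≡1 : ∀ m → qq m 0 ≡ + 1
qq0≡1 zero    = refl
qq0≡1 (suc m) = cong (λ c → c ℤ.* + 1 ℤ.+ + 0) (qq0≡1 m)

qqInf²⊛L-term : ∀ k j → qqInf ⊛ qqInf ⊛ L-term k j ≈ X^ k ⊛ V-term k j
qqInf²⊛L-term k j = begin
  qqInf ⊛ qqInf ⊛ (X^ (2 * j + k) ⊛ a⁻¹ ⊛ b⁻¹)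
    ≈⟨ *-cong (*-cong (qqInf-split j) (qqInf-split (j + k))) (*-congʳ {b⁻¹} (*-congʳ {a⁻¹} (X^-+ (2 * j) k))) ⟩
  (a ⊛ t) ⊛ (b ⊛ u) ⊛ (y ⊛ x ⊛ a⁻¹ ⊛ b⁻¹)
    ≈⟨ solve 8 (λ a t b u y x a⁻¹ b⁻¹ → (a :* t) :* (b :* u) :* (y :* x :* a⁻¹ :* b⁻¹) :=
                 (a :* a⁻¹) :* ((b :* b⁻¹) :* (x :* (y :* t :* u)))) ≈-refl a t b u y x a⁻¹ b⁻¹ ⟩
  (a ⊛ a⁻¹) ⊛ ((b ⊛ b⁻¹) ⊛ (x ⊛ (y ⊛ t ⊛ u)))
    ≈⟨ *-cong (⊛-inverseʳ a (qq0≡1 j)) (*-congʳ {x ⊛ (y ⊛ t ⊛ u)} (⊛-inverseʳ b (qq0≡1 (j + k)))) ⟩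
  𝟙 ⊛ (𝟙 ⊛ (x ⊛ (y ⊛ t ⊛ u)))
    ≈⟨ ≈-trans (⊛-identityˡ _) (⊛-identityˡ _) ⟩
  X^ k ⊛ V-term k j                  ∎
  where
  open SetoidReasoning setoid
  a = qq j
  b = qq (j + k)
  a⁻¹ = inv a
  b⁻¹ = inv b
  t = qqInfFrom j
  u = qqInfFrom (j + k)
  x = X^ k
  y = X^ (2 * j)

LHS≈q^kV : ∀ k → LHS k ≈ X^ k ⊛ V k
LHS≈q^kV k = begin
  qqInf ⊛ qqInf ⊛ Σ∞ (L-term k)                  ≈⟨ ⊛-Σ∞ (qqInf ⊛ qqInf) (L-summable k) ⟩
  Σ∞ (λ j → qqInf ⊛ qqInf ⊛ L-term k j)          ≈⟨ Σ∞-cong (qqInf²⊛L-term k) ⟩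
  Σ∞ (λ j → X^ k ⊛ V-term k j)                   ≈⟨ ⊛-Σ∞ (X^ k) (V-summable k) ⟨
  X^ k ⊛ V k                                     ∎
  where open SetoidReasoning setoid

q^k[S-qS]≈RHS : ∀ k → X^ k ⊛ (S k ⊕ ⊝ (X^ 1 ⊛ S (suc k))) ≈ RHS k
q^k[S-qS]≈RHS k = begin
  x ⊛ (S k ⊕ ⊝ (X^ 1 ⊛ S₁))
    ≈⟨ solve 4 (λ x s x₁ s₁ → x :* (s :+ :- (x₁ :* s₁)) := x :* s :+ :- ((x₁ :* x) :* s₁)) ≈-refl x (S k) (X^ 1) S₁ ⟩
  x ⊛ S k ⊕ ⊝ ((X^ 1 ⊛ x) ⊛ S₁)      ≈⟨ +-congˡ {x ⊛ S k} (-‿cong (*-congʳ {S₁} (X^-suc k))) ⟨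
  x ⊛ S k ⊕ ⊝ (X^ (suc k) ⊛ S₁)      ≈⟨ +-congˡ {x ⊛ S k} (-‿cong (𝟙⊕⊝-flip (S≈1-qS k))) ⟩
  x ⊛ S k ⊕ ⊝ (𝟙 ⊕ ⊝ S k)
    ≈⟨ solve 2 (λ x s → x :* s :+ :- (con (+ 1) :+ :- s) := con (- + 1) :+ (con (+ 1) :+ x) :* s) ≈-refl x (S k) ⟩
  RHS k                              ∎
  where
  open SetoidReasoning setoid
  x = X^ k
  S₁ = S (suc k)

U≈S : ∀ k → U k ≈ S k
U≈S = recurrence-unique U-recurrence S-recurrence λ k → ≈[]-trans (U≈[]𝟙 k) (≈[]-sym (S≈[]𝟙 k))

lemma1 : (k : ℕ) → (n : ℕ) → LHS k n ≡ RHS k n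
lemma1 k = coeff (begin
  LHS k                                  ≈⟨ LHS≈q^kV k ⟩
  X^ k ⊛ V k                             ≈⟨ *-congˡ {X^ k} (V≈U-qU k) ⟩
  X^ k ⊛ (U k ⊕ ⊝ (X^ 1 ⊛ U (suc k)))    ≈⟨ *-congˡ {X^ k} (+-cong (U≈S k) (-‿cong (*-congˡ {X^ 1} (U≈S (suc k))))) ⟩
  X^ k ⊛ (S k ⊕ ⊝ (X^ 1 ⊛ S (suc k)))    ≈⟨ q^k[S-qS]≈RHS k ⟩
  RHS k                                  ∎)
  where open SetoidReasoning setoid
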